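{- The systems $\mathbf{Pp}$ and $\mathbf{Mp}$ are each formula-complete and minimal-complete, but neither is sequent-complete.
   Context: Formulas are built from literals (propositional variables $P$ and their complements $\bar P$) using $\wedge$ and $\vee$. Negation satisfies $\neg P=\bar P$ and is extended by De Morgan's laws. A sequent is a nonempty finite multiset of formulas. A comma denotes multiset union, and $\Gamma,\Delta,\Sigma$ denote possibly empty multisets. A sequent $A_1,\dots,A_n$ is valid if $A_1\vee\cdots\vee A_n$ evaluates to $1$ under every $0/1$-assignment. A sequent is minimal if it is valid and no sequent obtained by deleting at least one of its formulas is valid. Rules: - Axiom: infer $P,\neg P$ from no premises. - $(\otimes)$: from $\Delta,A$ and $\Sigma,B$ infer $\Delta,\Sigma,A\wedge B$. - $(\wedge)$: from $\Gamma,\Delta,A$ and $\Gamma,\Sigma,B$ infer $\Gamma,\Delta,\Sigma,A\wedge B$. - $(\oplus_i)$ for $i=1,2$: from $\Gamma,A_i$ infer $\Gamma,A_1\vee A_2$. - $(\mathrm{par})$: from $\Gamma,A,B$ infer $\Gamma,A\vee B$. - $(\mathsf C)$: from $\Gamma,A,A$ infer $\Gamma,A$. The systems are: - $\mathbf{Pp}$ = axiom + $(\otimes),(\oplus_1),(\oplus_2),(\mathsf C)$; - $\mathbf{Mp}$ = axiom + $(\wedge),(\oplus_1),(\oplus_2),(\mathrm{par})$. A system is formula-complete if every valid formula (as a one-element sequent) is derivable. It is minimal-complete if every minimal sequent is derivable. It is sequent-complete if every valid sequent is derivable. -}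

module Defs where

open import Data.Nat using (ℕ)
open import Data.Bool using (Bool; true; false; not; _∧_; _∨_)
open import Data.List using (List; []; _∷_; _++_; [_])
open import Data.List.Relation.Binary.Permutation.Propositional using (_↭_)
open import Data.Product using (_×_; ∃; ∃₂)
open import Relation.Binary.PropositionalEquality using (_≡_)
open import Relation.Nullary using (¬_)

data Formula : Set where
  var  : ℕ → Formula
  nvar : ℕ → Formula
  _∧ᶠ_ : Formula → Formula → Formula
  _∨ᶠ_ : Formula → Formula → Formula

infixr 6 _∧ᶠ_
infixr 5 _∨ᶠ_

neg : Formula → Formula
neg (var p)  = nvar p
neg (nvar p) = var p
neg (A ∧ᶠ B) = neg A ∨ᶠ neg B
neg (A ∨ᶠ B) = neg A ∧ᶠ neg B

-- A sequent is a finite multiset of formulas, represented by a list;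
-- multiset equality is list permutation (_↭_).
Sequent : Set
Sequent = List Formula

Assignment : Set
Assignment = ℕ → Bool

eval : Assignment → Formula → Bool
eval ρ (var p)  = ρ p
eval ρ (nvar p) = not (ρ p)
eval ρ (A ∧ᶠ B) = eval ρ A ∧ eval ρ B
eval ρ (A ∨ᶠ B) = eval ρ A ∨ eval ρ B

evalSeq : Assignment → Sequent → Bool
evalSeq ρ []      = false
evalSeq ρ (A ∷ Γ) = eval ρ A ∨ evalSeq ρ Γ

NonEmpty : Sequent → Set
NonEmpty Γ = ¬ (Γ ≡ [])

Valid : Sequent → Set
Valid Γ = NonEmpty Γ × (∀ (ρ : Assignment) → evalSeq ρ Γ ≡ true)

ProperSubSequent : Sequent → Sequent → Set
ProperSubSequent Δ Γ = ∃ λ (E : Sequent) → NonEmpty E × (Γ ↭ (Δ ++ E))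

Minimal : Sequent → Set
Minimal Γ = Valid Γ × (∀ Δ → ProperSubSequent Δ Γ → ¬ Valid Δ)

-- The system Pp: axiom, (⊗), (⊕₁), (⊕₂), (C); sequents are multisets,
-- so derivability is closed under permutation (exchange).
data Pp⊢ : Sequent → Set where
  ax    : ∀ p → Pp⊢ (var p ∷ neg (var p) ∷ [])
  exch  : ∀ {Γ Γ'} → Γ ↭ Γ' → Pp⊢ Γ → Pp⊢ Γ'
  tensor : ∀ {Δ Σ A B} → Pp⊢ (Δ ++ [ A ]) → Pp⊢ (Σ ++ [ B ]) →
           Pp⊢ (Δ ++ Σ ++ [ A ∧ᶠ B ])
  plus₁ : ∀ {Γ A B} → Pp⊢ (Γ ++ [ A ]) → Pp⊢ (Γ ++ [ A ∨ᶠ B ])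
  plus₂ : ∀ {Γ A B} → Pp⊢ (Γ ++ [ B ]) → Pp⊢ (Γ ++ [ A ∨ᶠ B ])
  contr : ∀ {Γ A} → Pp⊢ (Γ ++ A ∷ A ∷ []) → Pp⊢ (Γ ++ [ A ])

data Mp⊢ : Sequent → Set where
  ax    : ∀ p → Mp⊢ (var p ∷ neg (var p) ∷ [])
  exch  : ∀ {Γ Γ'} → Γ ↭ Γ' → Mp⊢ Γ → Mp⊢ Γ'
  with∧ : ∀ {Γ Δ Σ A B} → Mp⊢ (Γ ++ Δ ++ [ A ]) → Mp⊢ (Γ ++ Σ ++ [ B ]) →
          Mp⊢ (Γ ++ Δ ++ Σ ++ [ A ∧ᶠ B ])
  plus₁ : ∀ {Γ A B} → Mp⊢ (Γ ++ [ A ]) → Mp⊢ (Γ ++ [ A ∨ᶠ B ])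
  plus₂ : ∀ {Γ A B} → Mp⊢ (Γ ++ [ B ]) → Mp⊢ (Γ ++ [ A ∨ᶠ B ])
  par   : ∀ {Γ A B} → Mp⊢ (Γ ++ A ∷ B ∷ []) → Mp⊢ (Γ ++ [ A ∨ᶠ B ])

FormulaComplete : (Sequent → Set) → Set
FormulaComplete ⊢ = ∀ (A : Formula) → Valid [ A ] → ⊢ [ A ]

MinimalComplete : (Sequent → Set) → Set
MinimalComplete ⊢ = ∀ (Γ : Sequent) → Minimal Γ → ⊢ Γ

SequentComplete : (Sequent → Set) → Set
SequentComplete ⊢ = ∀ (Γ : Sequent) → Valid Γ → ⊢ Γ

-- Both systems admit the rules of Mp with the principal formula in front of
-- the sequent; Pp obtains par and the additive ∧ from ⊗ by contracting the
-- duplicated context. For such a system every valid sequent Γ contains a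
-- valid derivable sub-multiset: decompose a compound formula of Γ and recurse
-- on the premises, which are smaller; for A ∧ B the derivable parts
-- A, G, D ⊑ A, Γ' and B, G, S ⊑ B, Γ' are merged along their common part G
-- into A ∧ B, G, D, S ⊑ Γ; a valid sequent of literals contains an axiom.
-- A minimal sequent equals that part, and a single valid formula is minimal.
-- Conversely a derivable sequent of literals has two formulas, like an axiom:
-- contraction cannot produce one, because P, P and P̄, P̄ are not valid. So
-- the valid sequent P, P̄, Q is not derivable.
module Submission where

open import Defs
open import Data.Bool using (true; false; not; _∨_; T)
open import Data.Bool.Properties using (T-∧; T-∨; T-≡)
open import Data.Empty using (⊥-elim)
open import Data.List using (List; []; _∷_; _++_; [_]; length; map)
open import Data.List.Membership.Propositional using (_∈_; find)
open import Data.List.Properties using (++-identityʳ; ++-conicalˡ; ++-conicalʳ; ∷-injectiveʳ)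
open import Data.List.Relation.Binary.Permutation.Propositional
  using (_↭_; refl; prep; swap; trans; ↭-refl; ↭-sym; ↭-reflexive)
open import Data.List.Relation.Binary.Permutation.Propositional.Properties
  using (++-commutativeMonoid; ∈-resp-↭; Any-resp-↭; All-resp-↭; ↭-length; ↭-singleton-inv;
         ↭-empty-inv; shift; drop-∷; ++-comm; ++⁺ˡ; ++⁺ʳ; map⁺)
open import Algebra.Solver.CommutativeMonoid (++-commutativeMonoid {A = Formula})
  using (solve; _⊕_; _⊜_)
open import Data.List.Membership.Propositional.Properties using (∈-∃++; ∈-++⁻)
open import Data.List.Relation.Unary.All using (All; []; _∷_; all?; lookup)
open import Data.List.Relation.Unary.All.Properties using (¬All⇒Any¬; ++⁺; ++⁻ˡ; ++⁻ʳ)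
open import Data.List.Relation.Unary.Any using (Any; here; there; any?)
open import Data.List.Relation.Unary.Any.Properties using () renaming (++⁺ˡ to Any-++⁺ˡ)
open import Data.Nat using (ℕ; suc; _+_; _<_; _≟_; s≤s)
open import Data.Nat.Induction using (<-wellFounded)
open import Data.Nat.ListAction using (sum)
open import Data.Nat.ListAction.Properties using (sum-↭)
open import Data.Nat.Properties using (+-assoc; +-monoˡ-≤; m≤m+n; m≤n+m; ≤-reflexive)
open import Data.Product using (Σ; ∃; _×_; _,_; proj₁; proj₂)
open import Data.Sum using (_⊎_; inj₁; inj₂) renaming ([_,_]′ to either)
open import Function using (_∘_; Equivalence)
open import Induction.WellFounded using (Acc; acc)
open import Relation.Binary.PropositionalEquality using (_≡_; _≢_; refl; sym; cong)
  renaming (trans to ≡-trans)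
open import Relation.Nullary using (Dec; yes; no; ¬_)
open import Relation.Nullary.Decidable using (isYes; map′; toWitness; toWitnessFalse)

open Equivalence using (to; from)

private
  variable
    A B C : Formula
    Γ Δ X Y : Sequent
    ρ : Assignment

-- Sub-multisets

module _ {a} {E : Set a} where

  infix 4 _⊑_

  _⊑_ : List E → List E → Set a
  xs ⊑ ys = ∃ λ rest → ys ↭ xs ++ rest

  ∈⇒↭∷ : ∀ {x : E} {xs} → x ∈ xs → ∃ λ ys → xs ↭ x ∷ ys
  ∈⇒↭∷ {x} x∈xs with ys , zs , refl ← ∈-∃++ x∈xs = ys ++ zs , shift x ys zs

  ↭-insert : ∀ {x : E} {xs ys zs} → xs ↭ ys ++ zs → x ∷ xs ↭ ys ++ x ∷ zs
  ↭-insert {x} {ys = ys} {zs} p = trans (prep x p) (↭-sym (shift x ys zs))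

  ⊑-respˡ : ∀ {xs ys zs : List E} → xs ↭ ys → xs ⊑ zs → ys ⊑ zs
  ⊑-respˡ p (rest , q) = rest , trans q (++⁺ʳ rest p)

  ⊑-respʳ : ∀ {xs ys zs : List E} → ys ↭ zs → xs ⊑ ys → xs ⊑ zs
  ⊑-respʳ p (rest , q) = rest , trans (↭-sym p) q

  ⊑-∷⁺ : ∀ {x} {xs ys : List E} → xs ⊑ ys → x ∷ xs ⊑ x ∷ ys
  ⊑-∷⁺ {x} (rest , q) = rest , prep x q

  ⊑-there : ∀ {x} {xs ys : List E} → xs ⊑ ys → xs ⊑ x ∷ ys
  ⊑-there {x} (rest , q) = x ∷ rest , ↭-insert q

  ⊑-∷⁻ : ∀ {x} {xs ys : List E} → xs ⊑ x ∷ ys →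
         (∃ λ xs′ → xs ↭ x ∷ xs′ × xs′ ⊑ ys) ⊎ xs ⊑ ys
  ⊑-∷⁻ {xs = xs} (rest , p) with ∈-++⁻ xs (∈-resp-↭ p (here refl))
  ... | inj₁ x∈xs = let xs′ , q = ∈⇒↭∷ x∈xs in
    inj₁ (xs′ , q , rest , drop-∷ (trans p (++⁺ʳ rest q)))
  ... | inj₂ x∈rest = let rest′ , q = ∈⇒↭∷ x∈rest in
    inj₂ (rest′ , drop-∷ (trans p (trans (++⁺ˡ xs q) (↭-sym (↭-insert ↭-refl)))))

  ⊑-[] : ∀ {xs : List E} → xs ⊑ [] → xs ≡ []
  ⊑-[] {xs} (rest , p) = ++-conicalˡ xs rest (↭-empty-inv (↭-sym p))

  ⊑-join : ∀ zs {xs ys : List E} → xs ⊑ zs → ys ⊑ zs →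
           ∃ λ common → ∃ λ onlyˣ → ∃ λ onlyʸ →
             xs ↭ common ++ onlyˣ × ys ↭ common ++ onlyʸ × common ++ onlyˣ ++ onlyʸ ⊑ zs
  ⊑-join [] xs⊑ ys⊑ rewrite ⊑-[] xs⊑ | ⊑-[] ys⊑ = [] , [] , [] , ↭-refl , ↭-refl , [] , ↭-refl
  ⊑-join (z ∷ zs) xs⊑ ys⊑ with ⊑-∷⁻ xs⊑ | ⊑-∷⁻ ys⊑
  ... | inj₁ (xs′ , p , xs′⊑) | inj₁ (ys′ , q , ys′⊑) =
    let G , D , S , p′ , q′ , u = ⊑-join zs xs′⊑ ys′⊑
    in z ∷ G , D , S , trans p (prep z p′) , trans q (prep z q′) , ⊑-∷⁺ u
  ... | inj₁ (xs′ , p , xs′⊑) | inj₂ ys⊑′ =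
    let G , D , S , p′ , q′ , u = ⊑-join zs xs′⊑ ys⊑′
    in G , z ∷ D , S , trans p (↭-insert p′) , q′ , ⊑-respˡ (↭-insert ↭-refl) (⊑-∷⁺ u)
  ... | inj₂ xs⊑′ | inj₁ (ys′ , q , ys′⊑) =
    let G , D , S , p′ , q′ , u = ⊑-join zs xs⊑′ ys′⊑
    in G , D , z ∷ S , p′ , trans q (↭-insert q′) ,
       ⊑-respˡ (trans (↭-insert ↭-refl) (++⁺ˡ G (↭-insert {ys = D} ↭-refl))) (⊑-∷⁺ u)
  ... | inj₂ xs⊑′ | inj₂ ys⊑′ =
    let G , D , S , p′ , q′ , u = ⊑-join zs xs⊑′ ys⊑′
    in G , D , S , p′ , q′ , ⊑-there u

  Any-⊑ : ∀ {p} {P : E → Set p} {xs ys} → xs ⊑ ys → Any P xs → Any P ys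
  Any-⊑ (_ , p) a = Any-resp-↭ (↭-sym p) (Any-++⁺ˡ a)

  ⊑-pair : ∀ {x y : E} {xs} → x ≢ y → x ∈ xs → y ∈ xs → x ∷ y ∷ [] ⊑ xs
  ⊑-pair {x} x≢y x∈xs y∈xs with xs′ , p ← ∈⇒↭∷ x∈xs with ∈-resp-↭ p y∈xs
  ... | here y≡x     = ⊥-elim (x≢y (sym y≡x))
  ... | there y∈xs′ with rest , q ← ∈⇒↭∷ y∈xs′ = rest , trans p (prep x q)

infix 4 _⊨_

_⊨_ : Assignment → Formula → Set
ρ ⊨ A = T (eval ρ A)

Tautology : Sequent → Set
Tautology Γ = ∀ ρ → Any (ρ ⊨_) Γ

evalSeq⇒Any : ∀ Γ → T (evalSeq ρ Γ) → Any (ρ ⊨_) Γ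
evalSeq⇒Any (A ∷ Γ) h = either here (there ∘ evalSeq⇒Any Γ) (to T-∨ h)

Any⇒evalSeq : Any (ρ ⊨_) Γ → T (evalSeq ρ Γ)
Any⇒evalSeq (here h)  = from T-∨ (inj₁ h)
Any⇒evalSeq (there a) = from T-∨ (inj₂ (Any⇒evalSeq a))

valid⇒tautology : Valid Γ → Tautology Γ
valid⇒tautology (_ , v) ρ = evalSeq⇒Any _ (from T-≡ (v ρ))

tautology⇒valid : Tautology Γ → Valid Γ
tautology⇒valid t = nonempty t , λ ρ → to T-≡ (Any⇒evalSeq (t ρ))
  where
  nonempty : Tautology Γ → NonEmpty Γ
  nonempty t refl with t (λ _ → true)
  ... | ()

axiom-tautology : ∀ p → Tautology (var p ∷ nvar p ∷ [])
axiom-tautology p ρ = evalSeq⇒Any _ (excluded-middle (ρ p))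
  where
  excluded-middle : ∀ b → T (b ∨ (not b ∨ false))
  excluded-middle true  = _
  excluded-middle false = _

tautology-resp-↭ : Γ ↭ Δ → Tautology Γ → Tautology Δ
tautology-resp-↭ p t ρ = Any-resp-↭ p (t ρ)

tautology-head : (∀ {ρ} → ρ ⊨ A → ρ ⊨ B) → Tautology (A ∷ Γ) → Tautology (B ∷ Γ)
tautology-head f t ρ with t ρ
... | here h  = here (f h)
... | there a = there a

∧-tautology⁻ˡ : Tautology ((A ∧ᶠ B) ∷ Γ) → Tautology (A ∷ Γ)
∧-tautology⁻ˡ = tautology-head (proj₁ ∘ to T-∧)

∧-tautology⁻ʳ : Tautology ((A ∧ᶠ B) ∷ Γ) → Tautology (B ∷ Γ)
∧-tautology⁻ʳ = tautology-head (proj₂ ∘ to T-∧)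

∧-tautology⁺ : X ⊑ Γ → Y ⊑ Γ → Tautology (A ∷ X) → Tautology (B ∷ Y) → Tautology ((A ∧ᶠ B) ∷ Γ)
∧-tautology⁺ X⊑Γ Y⊑Γ t₁ t₂ ρ with t₁ ρ | t₂ ρ
... | here a  | here b  = here (from T-∧ (a , b))
... | there x | _       = there (Any-⊑ X⊑Γ x)
... | here _  | there y = there (Any-⊑ Y⊑Γ y)

∨-tautology⁻ : Tautology ((A ∨ᶠ B) ∷ Γ) → Tautology (A ∷ B ∷ Γ)
∨-tautology⁻ t ρ with t ρ
... | here h  = either here (there ∘ here) (to T-∨ h)
... | there a = there (there a)

∨-tautology⁺ : Tautology (A ∷ B ∷ Γ) → Tautology ((A ∨ᶠ B) ∷ Γ)
∨-tautology⁺ t ρ with t ρ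
... | here a          = here (from T-∨ (inj₁ a))
... | there (here b)  = here (from T-∨ (inj₂ b))
... | there (there c) = there c

∨-tautology⁺ˡ : Tautology (A ∷ Γ) → Tautology ((A ∨ᶠ B) ∷ Γ)
∨-tautology⁺ˡ = tautology-head (from T-∨ ∘ inj₁)

∨-tautology⁺ʳ : Tautology (B ∷ Γ) → Tautology ((A ∨ᶠ B) ∷ Γ)
∨-tautology⁺ʳ = tautology-head (from T-∨ ∘ inj₂)

data Literal : Formula → Set where
  positive : ∀ {p} → Literal (var p)
  negative : ∀ {p} → Literal (nvar p)

literal? : ∀ A → Dec (Literal A)
literal? (var _)  = yes positive
literal? (nvar _) = yes negative
literal? (_ ∧ᶠ _) = no λ ()
literal? (_ ∨ᶠ _) = no λ ()

nvar≟ : ∀ p A → Dec (nvar p ≡ A)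
nvar≟ p (nvar q) = map′ (cong nvar) (λ { refl → refl }) (p ≟ q)
nvar≟ p (var _)  = no λ ()
nvar≟ p (_ ∧ᶠ _) = no λ ()
nvar≟ p (_ ∨ᶠ _) = no λ ()

-- Under the assignment making p true exactly when P̄ occurs in Γ, only a
-- complementary pair can make a sequent of literals true.
complementary-pair : All Literal Γ → Tautology Γ → ∃ λ p → var p ∈ Γ × nvar p ∈ Γ
complementary-pair {Γ} lits t with find (t λ p → isYes (any? (nvar≟ p) Γ))
... | A , A∈Γ , ρ⊨A with lookup lits A∈Γ
...   | positive {p} = p , A∈Γ , toWitness ρ⊨A
...   | negative     = ⊥-elim (toWitnessFalse ρ⊨A A∈Γ)

falsifier : Literal A → Σ Assignment λ ρ → ¬ ρ ⊨ A
falsifier positive = (λ _ → false) , λ ()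
falsifier negative = (λ _ → true) , λ ()

duplicated-literal-not-tautology : Literal A → length (Γ ++ A ∷ A ∷ []) ≡ 2 →
                                   ¬ Tautology (Γ ++ A ∷ A ∷ [])
duplicated-literal-not-tautology {Γ = []} lit _ t with ρ , ρ⊭A ← falsifier lit with t ρ
... | here h         = ρ⊭A h
... | there (here h) = ρ⊭A h
duplicated-literal-not-tautology {Γ = _ ∷ []}        _ ()
duplicated-literal-not-tautology {Γ = _ ∷ _ ∷ []}    _ ()
duplicated-literal-not-tautology {Γ = _ ∷ _ ∷ _ ∷ _} _ ()

data Shape (Γ : Sequent) : Set where
  literals    : All Literal Γ → Shape Γ
  conjunction : Γ ↭ (A ∧ᶠ B) ∷ Δ → Shape Γ
  disjunction : Γ ↭ (A ∨ᶠ B) ∷ Δ → Shape Γ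

shape : ∀ Γ → Shape Γ
shape Γ with all? literal? Γ
... | yes lits = literals lits
... | no ¬lits with find (¬All⇒Any¬ literal? Γ ¬lits)
...   | var _    , _ , ¬lit = ⊥-elim (¬lit positive)
...   | nvar _   , _ , ¬lit = ⊥-elim (¬lit negative)
...   | _ ∧ᶠ _   , C∈Γ , _  = conjunction (proj₂ (∈⇒↭∷ C∈Γ))
...   | _ ∨ᶠ _   , C∈Γ , _  = disjunction (proj₂ (∈⇒↭∷ C∈Γ))

formula-size : Formula → ℕ
formula-size (var _)  = 1
formula-size (nvar _) = 1
formula-size (A ∧ᶠ B) = suc (formula-size A + formula-size B)
formula-size (A ∨ᶠ B) = suc (formula-size A + formula-size B)

size : Sequent → ℕ
size Γ = sum (map formula-size Γ)

size-↭ : Γ ↭ Δ → size Γ ≡ size Δ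
size-↭ p = sum-↭ (map⁺ formula-size p)

size-∧ˡ : Γ ↭ (A ∧ᶠ B) ∷ Δ → size (A ∷ Δ) < size Γ
size-∧ˡ {A = A} {B} {Δ} p rewrite size-↭ p =
  s≤s (+-monoˡ-≤ (size Δ) (m≤m+n (formula-size A) (formula-size B)))

size-∧ʳ : Γ ↭ (A ∧ᶠ B) ∷ Δ → size (B ∷ Δ) < size Γ
size-∧ʳ {A = A} {B} {Δ} p rewrite size-↭ p =
  s≤s (+-monoˡ-≤ (size Δ) (m≤n+m (formula-size B) (formula-size A)))

size-∨ : Γ ↭ (A ∨ᶠ B) ∷ Δ → size (A ∷ B ∷ Δ) < size Γ
size-∨ {A = A} {B} {Δ} p rewrite size-↭ p =
  s≤s (≤-reflexive (sym (+-assoc (formula-size A) (formula-size B) (size Δ))))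

-- Completeness of systems admitting the rules of Mp

record MpClosed (⊢_ : Sequent → Set) : Set where
  field
    axiom    : ∀ p → ⊢ (var p ∷ nvar p ∷ [])
    exchange : Γ ↭ Δ → ⊢ Γ → ⊢ Δ
    ⊕₁-head  : ⊢ (A ∷ Γ) → ⊢ ((A ∨ᶠ B) ∷ Γ)
    ⊕₂-head  : ⊢ (B ∷ Γ) → ⊢ ((A ∨ᶠ B) ∷ Γ)
    par-head : ⊢ (A ∷ B ∷ Γ) → ⊢ ((A ∨ᶠ B) ∷ Γ)
    ∧-head   : ∀ G D S → ⊢ (A ∷ G ++ D) → ⊢ (B ∷ G ++ S) → ⊢ ((A ∧ᶠ B) ∷ G ++ D ++ S)

module Completeness {⊢_ : Sequent → Set} (closed : MpClosed ⊢_) where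
  open MpClosed closed

  record DerivablePart (Γ : Sequent) : Set where
    constructor part
    field
      {Θ}        : Sequent
      Θ⊑Γ        : Θ ⊑ Γ
      tautology  : Tautology Θ
      derivation : ⊢ Θ

  part-resp-↭ : Γ ↭ Δ → DerivablePart Γ → DerivablePart Δ
  part-resp-↭ p (part s t d) = part (⊑-respʳ p s) t d

  literal-part : All Literal Γ → Tautology Γ → DerivablePart Γ
  literal-part lits t with p , P∈Γ , P̄∈Γ ← complementary-pair lits t =
    part (⊑-pair (λ ()) P∈Γ P̄∈Γ) (axiom-tautology p) (axiom p)

  ∧-part : DerivablePart (A ∷ Γ) → DerivablePart (B ∷ Γ) → DerivablePart ((A ∧ᶠ B) ∷ Γ)
  ∧-part {A} {Γ} {B} (part s₁ t₁ d₁) (part s₂ t₂ d₂) with ⊑-∷⁻ s₁ | ⊑-∷⁻ s₂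
  ... | inj₂ s₁′ | _        = part (⊑-there s₁′) t₁ d₁
  ... | inj₁ _   | inj₂ s₂′ = part (⊑-there s₂′) t₂ d₂
  ... | inj₁ (X , p₁ , X⊑Γ) | inj₁ (Y , p₂ , Y⊑Γ)
    with G , D , S , q₁ , q₂ , GDS⊑Γ ← ⊑-join Γ X⊑Γ Y⊑Γ =
    part (⊑-∷⁺ GDS⊑Γ)
         (∧-tautology⁺ GD⊑GDS GS⊑GDS (tautology-resp-↭ r₁ t₁) (tautology-resp-↭ r₂ t₂))
         (∧-head G D S (exchange r₁ d₁) (exchange r₂ d₂))
    where
    r₁ = trans p₁ (prep A q₁)
    r₂ = trans p₂ (prep B q₂)
    GD⊑GDS : G ++ D ⊑ G ++ D ++ S
    GD⊑GDS = S , solve 3 (λ g d s → g ⊕ (d ⊕ s) ⊜ (g ⊕ d) ⊕ s) ↭-refl G D S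
    GS⊑GDS : G ++ S ⊑ G ++ D ++ S
    GS⊑GDS = D , solve 3 (λ g d s → g ⊕ (d ⊕ s) ⊜ (g ⊕ s) ⊕ d) ↭-refl G D S

  ∨-part : DerivablePart (A ∷ B ∷ Γ) → DerivablePart ((A ∨ᶠ B) ∷ Γ)
  ∨-part {A} (part s t d) with ⊑-∷⁻ s
  ... | inj₁ (Θ₁ , p₁ , s₁) with ⊑-∷⁻ s₁
  ...   | inj₁ (Θ₂ , p₂ , s₂) = let r = trans p₁ (prep A p₂) in
    part (⊑-∷⁺ s₂) (∨-tautology⁺ (tautology-resp-↭ r t)) (par-head (exchange r d))
  ...   | inj₂ s₁′ =
    part (⊑-∷⁺ s₁′) (∨-tautology⁺ˡ (tautology-resp-↭ p₁ t)) (⊕₁-head (exchange p₁ d))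
  ∨-part (part s t d) | inj₂ s′ with ⊑-∷⁻ s′
  ...   | inj₁ (Θ₂ , p₂ , s₂) =
    part (⊑-∷⁺ s₂) (∨-tautology⁺ʳ (tautology-resp-↭ p₂ t)) (⊕₂-head (exchange p₂ d))
  ...   | inj₂ s″ = part (⊑-there s″) t d

  derivable-part : Tautology Γ → DerivablePart Γ
  derivable-part {Γ} = go Γ (<-wellFounded (size Γ))
    where
    go : ∀ Γ → Acc _<_ (size Γ) → Tautology Γ → DerivablePart Γ
    go Γ (acc smaller) t with shape Γ
    ... | literals lits = literal-part lits t
    ... | conjunction {A} {B} {Δ} p =
      part-resp-↭ (↭-sym p)
        (∧-part (go (A ∷ Δ) (smaller (size-∧ˡ p)) (∧-tautology⁻ˡ (tautology-resp-↭ p t)))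
                (go (B ∷ Δ) (smaller (size-∧ʳ p)) (∧-tautology⁻ʳ (tautology-resp-↭ p t))))
    ... | disjunction {A} {B} {Δ} p =
      part-resp-↭ (↭-sym p)
        (∨-part (go (A ∷ B ∷ Δ) (smaller (size-∨ p)) (∨-tautology⁻ (tautology-resp-↭ p t))))

  minimal-complete : MinimalComplete ⊢_
  minimal-complete Γ (valid , minimal) with derivable-part (valid⇒tautology valid)
  ... | part {Θ} ([] , p) _ d = exchange (↭-sym (trans p (↭-reflexive (++-identityʳ Θ)))) d
  ... | part {Θ} (e ∷ E , p) t _ = ⊥-elim (minimal Θ (e ∷ E , (λ ()) , p) (tautology⇒valid t))

singleton-minimal : Valid [ A ] → Minimal [ A ]
singleton-minimal v = v , no-valid-proper-part
  where
  no-valid-proper-part : ∀ Δ → ProperSubSequent Δ [ _ ] → ¬ Valid Δ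
  no-valid-proper-part []      _                 (Δ≢[] , _) = Δ≢[] refl
  no-valid-proper-part (_ ∷ Δ) ([] , E≢[] , _)   _          = E≢[] refl
  no-valid-proper-part (_ ∷ Δ) (e ∷ E , _ , p)   _
    with () ← ++-conicalʳ Δ (e ∷ E) (∷-injectiveʳ (↭-singleton-inv (↭-sym p)))

minimal⇒formula-complete : ∀ {⊢_ : Sequent → Set} → MinimalComplete ⊢_ → FormulaComplete ⊢_
minimal⇒formula-complete complete A valid = complete [ A ] (singleton-minimal valid)

rule-at-head : ∀ {⊢_ : Sequent → Set} (Π : Sequent) →
               (∀ {Γ Δ} → Γ ↭ Δ → ⊢ Γ → ⊢ Δ) →
               (∀ {Γ} → ⊢ (Γ ++ Π) → ⊢ (Γ ++ [ C ])) → ⊢ (Π ++ Γ) → ⊢ (C ∷ Γ)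
rule-at-head {C = C} {Γ} Π exchange rule d =
  exchange (++-comm Γ [ C ]) (rule (exchange (++-comm Π Γ) d))

last↭head : ∀ C G D S → G ++ D ++ S ++ [ C ] ↭ C ∷ G ++ D ++ S
last↭head C G D S = solve 4 (λ c g d s → g ⊕ (d ⊕ (s ⊕ c)) ⊜ c ⊕ (g ⊕ (d ⊕ s))) ↭-refl [ C ] G D S

Pp-at-head : ∀ Π → (∀ {Γ} → Pp⊢ (Γ ++ Π) → Pp⊢ (Γ ++ [ C ])) → Pp⊢ (Π ++ Γ) → Pp⊢ (C ∷ Γ)
Pp-at-head Π = rule-at-head {⊢_ = Pp⊢} Π exch

Pp-⊕₁ : Pp⊢ (A ∷ Γ) → Pp⊢ ((A ∨ᶠ B) ∷ Γ)
Pp-⊕₁ = Pp-at-head [ _ ] plus₁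

Pp-⊕₂ : Pp⊢ (B ∷ Γ) → Pp⊢ ((A ∨ᶠ B) ∷ Γ)
Pp-⊕₂ = Pp-at-head [ _ ] plus₂

Pp-contraction : Pp⊢ (A ∷ A ∷ Γ) → Pp⊢ (A ∷ Γ)
Pp-contraction {A} = Pp-at-head (A ∷ A ∷ []) contr

Pp-par : Pp⊢ (A ∷ B ∷ Γ) → Pp⊢ ((A ∨ᶠ B) ∷ Γ)
Pp-par d = Pp-contraction (Pp-⊕₁ (exch (swap _ _ ↭-refl) (Pp-⊕₂ (exch (swap _ _ ↭-refl) d))))

Pp-contractions : ∀ G → Pp⊢ (G ++ G ++ Γ) → Pp⊢ (G ++ Γ)
Pp-contractions         []      d = d
Pp-contractions {Γ} (g ∷ G) d =
  exch (shift g G Γ)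
    (Pp-contractions G (exch (solve 3 (λ x xs ys → x ⊕ (xs ⊕ (xs ⊕ ys)) ⊜ xs ⊕ (xs ⊕ (x ⊕ ys)))
                                     ↭-refl [ g ] G Γ)
      (Pp-contraction (exch (prep g (shift g G (G ++ Γ))) d))))

Pp-∧ : ∀ G D S → Pp⊢ (A ∷ G ++ D) → Pp⊢ (B ∷ G ++ S) → Pp⊢ ((A ∧ᶠ B) ∷ G ++ D ++ S)
Pp-∧ {A} {B} G D S d₁ d₂ =
  exch (last↭head (A ∧ᶠ B) G D S)
    (Pp-contractions G (exch (solve 4 (λ c g d s → (g ⊕ d) ⊕ ((g ⊕ s) ⊕ c) ⊜ g ⊕ (g ⊕ (d ⊕ (s ⊕ c))))
                                      ↭-refl [ A ∧ᶠ B ] G D S)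
      (tensor (exch (++-comm [ A ] (G ++ D)) d₁) (exch (++-comm [ B ] (G ++ S)) d₂))))

Pp-closed : MpClosed Pp⊢
Pp-closed = record
  { axiom    = ax
  ; exchange = exch
  ; ⊕₁-head  = Pp-⊕₁
  ; ⊕₂-head  = Pp-⊕₂
  ; par-head = Pp-par
  ; ∧-head   = Pp-∧
  }

Mp-at-head : ∀ Π → (∀ {Γ} → Mp⊢ (Γ ++ Π) → Mp⊢ (Γ ++ [ C ])) → Mp⊢ (Π ++ Γ) → Mp⊢ (C ∷ Γ)
Mp-at-head Π = rule-at-head {⊢_ = Mp⊢} Π exch

Mp-∧ : ∀ G D S → Mp⊢ (A ∷ G ++ D) → Mp⊢ (B ∷ G ++ S) → Mp⊢ ((A ∧ᶠ B) ∷ G ++ D ++ S)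
Mp-∧ {A} {B} G D S d₁ d₂ =
  exch (last↭head (A ∧ᶠ B) G D S)
    (with∧ {G} {D} {S} (exch (head↭last A G D) d₁) (exch (head↭last B G S) d₂))
  where
  head↭last : ∀ A G D → A ∷ G ++ D ↭ G ++ D ++ [ A ]
  head↭last A G D = solve 3 (λ a g d → a ⊕ (g ⊕ d) ⊜ g ⊕ (d ⊕ a)) ↭-refl [ A ] G D

Mp-closed : MpClosed Mp⊢
Mp-closed = record
  { axiom    = ax
  ; exchange = exch
  ; ⊕₁-head  = Mp-at-head [ _ ] plus₁
  ; ⊕₂-head  = Mp-at-head [ _ ] plus₂
  ; par-head = λ {A} {B} → Mp-at-head (A ∷ B ∷ []) par
  ; ∧-head   = Mp-∧
  }

-- Incompleteness for sequents

Pp-literal-sequent : Pp⊢ Γ → All Literal Γ → length Γ ≡ 2 × Tautology Γ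
Pp-literal-sequent (ax p) _ = refl , axiom-tautology p
Pp-literal-sequent (exch p d) lits
  with len , t ← Pp-literal-sequent d (All-resp-↭ (↭-sym p) lits) =
  ≡-trans (sym (↭-length p)) len , tautology-resp-↭ p t
Pp-literal-sequent (tensor {Δ} {Σ} _ _) lits with () ∷ _ ← ++⁻ʳ Σ (++⁻ʳ Δ lits)
Pp-literal-sequent (plus₁ {Γ} _) lits with () ∷ _ ← ++⁻ʳ Γ lits
Pp-literal-sequent (plus₂ {Γ} _) lits with () ∷ _ ← ++⁻ʳ Γ lits
Pp-literal-sequent (contr {Γ} d) lits with lit ∷ [] ← ++⁻ʳ Γ lits
  with len , t ← Pp-literal-sequent d (++⁺ (++⁻ˡ Γ lits) (lit ∷ lit ∷ [])) =
  ⊥-elim (duplicated-literal-not-tautology lit len t)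

Mp-literal-sequent : Mp⊢ Γ → All Literal Γ → length Γ ≡ 2
Mp-literal-sequent (ax p) _ = refl
Mp-literal-sequent (exch p d) lits =
  ≡-trans (sym (↭-length p)) (Mp-literal-sequent d (All-resp-↭ (↭-sym p) lits))
Mp-literal-sequent (with∧ {Γ} {Δ} {Σ} _ _) lits with () ∷ _ ← ++⁻ʳ Σ (++⁻ʳ Δ (++⁻ʳ Γ lits))
Mp-literal-sequent (plus₁ {Γ} _) lits with () ∷ _ ← ++⁻ʳ Γ lits
Mp-literal-sequent (plus₂ {Γ} _) lits with () ∷ _ ← ++⁻ʳ Γ lits
Mp-literal-sequent (par {Γ} _) lits with () ∷ _ ← ++⁻ʳ Γ lits

weakened-axiom : Sequent
weakened-axiom = var 0 ∷ nvar 0 ∷ var 1 ∷ []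

weakened-axiom-valid : Valid weakened-axiom
weakened-axiom-valid = (λ ()) , λ ρ → excluded-middle (ρ 0) (ρ 1)
  where
  excluded-middle : ∀ b c → b ∨ (not b ∨ (c ∨ false)) ≡ true
  excluded-middle true  _ = refl
  excluded-middle false _ = refl

weakened-axiom-literals : All Literal weakened-axiom
weakened-axiom-literals = positive ∷ negative ∷ positive ∷ []

Pp-not-sequent-complete : ¬ SequentComplete Pp⊢
Pp-not-sequent-complete complete
  with () , _ ← Pp-literal-sequent (complete _ weakened-axiom-valid) weakened-axiom-literals

Mp-not-sequent-complete : ¬ SequentComplete Mp⊢
Mp-not-sequent-complete complete
  with () ← Mp-literal-sequent (complete _ weakened-axiom-valid) weakened-axiom-literals

proposition24 : (FormulaComplete Pp⊢ × MinimalComplete Pp⊢ × ¬ SequentComplete Pp⊢)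
                × (FormulaComplete Mp⊢ × MinimalComplete Mp⊢ × ¬ SequentComplete Mp⊢)
proposition24 =
    (minimal⇒formula-complete Pp.minimal-complete , Pp.minimal-complete , Pp-not-sequent-complete)
  , (minimal⇒formula-complete Mp.minimal-complete , Mp.minimal-complete , Mp-not-sequent-complete)
  where
  module Pp = Completeness Pp-closed
  module Mp = Completeness Mp-closed
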